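{- Let $a=(a_1,\dots,a_\ell)$ be a weak composition having two entries with $0<a_i<a_j$ and $i<j$. Then the expansion of $\kappa_a$ into fundamental slide polynomials has at least two different terms, that is, there are $T,T'\in\mathrm{QKT}(a)$ with $\mathrm{wt}(T)\neq\mathrm{wt}(T')$.
   Context: A weak composition $a=(a_1,\dots,a_\ell)$ of length $\ell$ is a finite sequence of nonnegative integers. A diagram is a finite set of cells $(r,c)$ with $r,c$ positive integers (row $r$ from the bottom, column $c$ from the left). A Kohnert tableau of content $a$ is a diagram filled with positive integers, exactly $a_i$ cells containing $i$ for each $i$, such that: (i) for each $i$ there is exactly one $i$ in each of the columns $1,\dots,a_i$; (ii) every entry in row $r$ is at least $r$; (iii) for each $i$, the cells containing $i$ weakly descend from left to right; (iv) if $i<j$ appear in the same column with $i$ above $j$, then there is an $i$ in the column immediately to the right of the cell containing that $j$, in a row strictly above it. It is quasi-Yamanouchi if moreover (v) for each nonempty row $r$, either row $r$ contains an entry equal to $r$, or some cell of row $r+1$ lies weakly to the right of some cell of row $r$. $\mathrm{QKT}(a)$ is the set of quasi-Yamanouchi Kohnert tableaux of content $a$, and $\mathrm{wt}(T)$ is the weak composition of length $\ell$ whose $r$-th part is the number of cells in row $r$ of $T$. The key polynomial $\kappa_a$ satisfies $\kappa_a=\sum_{T\in\mathrm{QKT}(a)}\mathfrak{F}_{\mathrm{wt}(T)}$, where $\mathfrak{F}_b$ is the fundamental slide polynomial; the terms of this expansion are the $\mathfrak{F}_{\mathrm{wt}(T)}$, $T\in\mathrm{QKT}(a)$. -}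

module Defs where

open import Data.Nat using (ℕ; zero; suc; _≤_; _<_; _≟_)
open import Data.Product using (_×_; ∃-syntax; _,_)
open import Data.Product.Properties using ()
open import Data.Sum using (_⊎_)
open import Data.List using (List; []; _∷_; length; filter; map; upTo)
open import Data.List.Membership.Propositional using (_∈_)
open import Data.List.Relation.Unary.Unique.Propositional using (Unique)
open import Relation.Nullary.Decidable using (_×-dec_)
open import Relation.Binary.PropositionalEquality using (_≡_)

WeakComp : Set
WeakComp = List ℕ

-- 1-based access: part a i = a_i for 1 ≤ i ≤ ℓ (0 outside this range).
part : WeakComp → ℕ → ℕ
part []       _             = 0
part (x ∷ xs) zero          = 0
part (x ∷ xs) (suc zero)    = x
part (x ∷ xs) (suc (suc n)) = part xs (suc n)

-- A filled cell: position (row, col) (row from the bottom, col from the left)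
-- together with its entry.
record Cell : Set where
  constructor cell
  field
    row : ℕ
    col : ℕ
    ent : ℕ
open Cell public

Filling : Set
Filling = List Cell

pos : Cell → ℕ × ℕ
pos x = row x , col x

countEnt : ℕ → Filling → ℕ
countEnt i T = length (filter (λ x → ent x ≟ i) T)

countEntCol : ℕ → ℕ → Filling → ℕ
countEntCol i c T = length (filter (λ x → (ent x ≟ i) ×-dec (col x ≟ c)) T)

countRow : ℕ → Filling → ℕ
countRow r T = length (filter (λ x → row x ≟ r) T)

record IsKohnertTableau (a : WeakComp) (T : Filling) : Set where
  field
    distinct   : Unique (map pos T)
    rowPos     : ∀ x → x ∈ T → 1 ≤ row x
    colPos     : ∀ x → x ∈ T → 1 ≤ col x
    entRange   : ∀ x → x ∈ T → 1 ≤ ent x × ent x ≤ length a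
    content    : ∀ i → 1 ≤ i → i ≤ length a → countEnt i T ≡ part a i
    condI      : ∀ i → 1 ≤ i → i ≤ length a →
                 ∀ c → 1 ≤ c → c ≤ part a i → countEntCol i c T ≡ 1
    condII     : ∀ x → x ∈ T → row x ≤ ent x
    condIII    : ∀ x y → x ∈ T → y ∈ T → ent x ≡ ent y →
                 col x < col y → row y ≤ row x
    condIV     : ∀ x y → x ∈ T → y ∈ T → ent x < ent y →
                 col x ≡ col y → row y < row x →
                 ∃[ z ] (z ∈ T × ent z ≡ ent x × col z ≡ suc (col y)
                         × row y < row z)

QuasiYamanouchi : Filling → Set
QuasiYamanouchi T =
  ∀ x → x ∈ T →
    (∃[ z ] (z ∈ T × row z ≡ row x × ent z ≡ row x))
    ⊎ (∃[ y ] ∃[ z ] (y ∈ T × z ∈ T × row y ≡ suc (row x)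
                      × row z ≡ row x × col z ≤ col y))

IsQKT : WeakComp → Filling → Set
IsQKT a T = IsKohnertTableau a T × QuasiYamanouchi T

wt : ℕ → Filling → List ℕ
wt ℓ T = map (λ k → countRow (suc k) T) (upTo ℓ)

module Submission where

-- The key tableau of a (row r holding a_r copies of r in columns 1, …, a_r) is
-- quasi-Yamanouchi.  Take the least j > i with a_j > a_i and move the last cell of
-- row j (column a_j, entry j) down to row i.  Condition (iv) could only fail for a
-- cell in column a_j of a row strictly between i and j, and there is none because
-- those rows have length at most a_i < a_j.  Row i has gained a cell, so the two
-- tableaux have different weights.

open import Defs
open import Data.Nat using (ℕ; zero; suc; pred; _+_; _≤_; _<_; _≟_; _<?_; z≤n; s≤s; >-nonZero)
open import Data.Nat.Properties
open import Data.Product using (_×_; _,_; ∃-syntax; proj₁; proj₂; map₂)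
open import Data.Sum using (inj₁)
open import Data.List using (List; []; _∷_; _++_; length; map; filter; concat; applyUpTo; applyDownFrom)
open import Data.List.Properties
  using (filter-++; length-++; filter-all; filter-none; filter-accept; filter-reject; length-applyDownFrom; map-upTo)
open import Data.List.Membership.Propositional using (_∈_)
open import Data.List.Membership.Propositional.Properties
  using (∈-concat⁺′; ∈-concat⁻′; ∈-applyUpTo⁺; ∈-applyUpTo⁻; ∈-applyDownFrom⁺; ∈-applyDownFrom⁻)
open import Data.List.Relation.Unary.All as All using (All)
import Data.List.Relation.Unary.All.Properties as All
open import Data.List.Relation.Unary.AllPairs using (AllPairs; _∷_)
open import Data.List.Relation.Unary.Unique.Propositional using (Unique)
open import Data.List.Relation.Unary.Any using (here; there)
import Data.List.Relation.Unary.AllPairs.Properties as AllPairs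
open import Relation.Nullary using (¬_; yes; no; contradiction)
open import Relation.Nullary.Decidable using (_×-dec_)
open import Relation.Unary using (Pred; Decidable; ∁)
open import Function using (_∘_)
open import Relation.Binary.PropositionalEquality using (_≡_; _≢_; refl; sym; trans; cong; cong₂; subst; subst₂)
open import Level using (Level)

private
  variable
    ℓ : Level
    A : Set

count : {P : Pred A ℓ} → Decidable P → List A → ℕ
count P? xs = length (filter P? xs)

module _ {P : Pred A ℓ} (P? : Decidable P) where

  count-++ : ∀ xs ys → count P? (xs ++ ys) ≡ count P? xs + count P? ys
  count-++ xs ys = trans (cong length (filter-++ P? xs ys)) (length-++ (filter P? xs))

  count-accept : ∀ {x} xs → P x → count P? (x ∷ xs) ≡ suc (count P? xs)
  count-accept _ P[x] = cong length (filter-accept P? P[x])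

  count-reject : ∀ {x} xs → ¬ P x → count P? (x ∷ xs) ≡ count P? xs
  count-reject _ ¬P[x] = cong length (filter-reject P? ¬P[x])

  count-all : ∀ {xs} → All P xs → count P? xs ≡ length xs
  count-all Pxs = cong length (filter-all P? Pxs)

  count-none : ∀ {xs} → All (∁ P) xs → count P? xs ≡ 0
  count-none ¬Pxs = cong length (filter-none P? ¬Pxs)

  count-concat-applyUpTo-none : ∀ (f : ℕ → List A) n → (∀ m → count P? (f m) ≡ 0) →
                                count P? (concat (applyUpTo f n)) ≡ 0
  count-concat-applyUpTo-none f zero    vanish = refl
  count-concat-applyUpTo-none f (suc n) vanish =
    trans (count-++ (f 0) _)
          (cong₂ _+_ (vanish 0)
                     (count-concat-applyUpTo-none (λ m → f (suc m)) n (λ m → vanish (suc m))))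

  count-concat-applyUpTo : ∀ (f : ℕ → List A) {n k} → k < n →
                           (∀ {m} → m ≢ k → count P? (f m) ≡ 0) →
                           count P? (concat (applyUpTo f n)) ≡ count P? (f k)
  count-concat-applyUpTo f {suc n} {zero} _ vanish =
    trans (count-++ (f 0) _)
          (trans (cong (count P? (f 0) +_)
                       (count-concat-applyUpTo-none (λ m → f (suc m)) n (λ m → vanish λ ())))
                 (+-identityʳ _))
  count-concat-applyUpTo f {suc n} {suc k} (s≤s k<n) vanish =
    trans (count-++ (f 0) _)
          (cong₂ _+_ (vanish λ ())
                     (count-concat-applyUpTo (λ m → f (suc m)) k<n (λ m≢k → vanish (m≢k ∘ suc-injective))))

least-witness : ∀ {P : Pred ℕ ℓ} → Decidable P → ∀ {n} → P n →
                ∃[ m ] (P m × (∀ {k} → k < m → ¬ P k))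
least-witness {P = P} P? {n} Pn = search (suc n) (n , ≤-refl , Pn)
  where
  search : ∀ v → ∃[ k ] (k < v × P k) → ∃[ m ] (P m × (∀ {k} → k < m → ¬ P k))
  search (suc v) (k , k<1+v , Pk) with anyUpTo? P? v
  ... | yes earlier = search v earlier
  ... | no none     = k , Pk , λ l<k Pl → none (_ , <-≤-trans l<k (≤-pred k<1+v) , Pl)

part-applyUpTo : ∀ (f : ℕ → ℕ) {n k} → k < n → part (applyUpTo f n) (suc k) ≡ f k
part-applyUpTo f {suc n} {zero}  _         = refl
part-applyUpTo f {suc n} {suc k} (s≤s k<n) = part-applyUpTo (λ m → f (suc m)) k<n

part-wt : ∀ {ℓ r} T → 1 ≤ r → r ≤ ℓ → part (wt ℓ T) r ≡ countRow r T
part-wt {ℓ} {suc r} T _ r<ℓ =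
  trans (cong (λ w → part w (suc r)) (map-upTo (λ k → countRow (suc k) T) ℓ))
        (part-applyUpTo (λ k → countRow (suc k) T) r<ℓ)

countRow-≢⇒wt-≢ : ∀ {ℓ r} T T′ → 1 ≤ r → r ≤ ℓ →
                  countRow r T ≢ countRow r T′ → wt ℓ T ≢ wt ℓ T′
countRow-≢⇒wt-≢ {ℓ} {r} T T′ 1≤r r≤ℓ rows≢ wts≡ =
  rows≢ (trans (sym (part-wt T 1≤r r≤ℓ)) (trans (cong (λ w → part w r) wts≡) (part-wt T′ 1≤r r≤ℓ)))

decrementAt : ℕ → WeakComp → WeakComp
decrementAt zero          a        = a
decrementAt (suc _)       []       = []
decrementAt (suc zero)    (x ∷ xs) = pred x ∷ xs
decrementAt (suc (suc j)) (x ∷ xs) = x ∷ decrementAt (suc j) xs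

length-decrementAt : ∀ j a → length (decrementAt j a) ≡ length a
length-decrementAt zero          a        = refl
length-decrementAt (suc _)       []       = refl
length-decrementAt (suc zero)    (x ∷ xs) = refl
length-decrementAt (suc (suc j)) (x ∷ xs) = cong suc (length-decrementAt (suc j) xs)

part-decrementAt-≡ : ∀ j a → part (decrementAt j a) j ≡ pred (part a j)
part-decrementAt-≡ zero          []       = refl
part-decrementAt-≡ zero          (x ∷ xs) = refl
part-decrementAt-≡ (suc _)       []       = refl
part-decrementAt-≡ (suc zero)    (x ∷ xs) = refl
part-decrementAt-≡ (suc (suc j)) (x ∷ xs) = part-decrementAt-≡ (suc j) xs

part-decrementAt-≢ : ∀ j a {k} → k ≢ j → part (decrementAt j a) k ≡ part a k
part-decrementAt-≢ zero          a                        _   = refl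
part-decrementAt-≢ (suc _)       []                       _   = refl
part-decrementAt-≢ (suc zero)    (x ∷ xs) {zero}          _   = refl
part-decrementAt-≢ (suc zero)    (x ∷ xs) {suc zero}      k≢j = contradiction refl k≢j
part-decrementAt-≢ (suc zero)    (x ∷ xs) {suc (suc k)}   _   = refl
part-decrementAt-≢ (suc (suc j)) (x ∷ xs) {zero}          _   = refl
part-decrementAt-≢ (suc (suc j)) (x ∷ xs) {suc zero}      _   = refl
part-decrementAt-≢ (suc (suc j)) (x ∷ xs) {suc (suc k)}   k≢j =
  part-decrementAt-≢ (suc j) xs (λ k≡j → k≢j (cong suc k≡j))

keyRow : ℕ → ℕ → Filling
keyRow r = applyDownFrom (λ c → cell r (suc c) r)

keyRows : WeakComp → ℕ → Filling
keyRows b k = keyRow (suc k) (part b (suc k))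

key : WeakComp → Filling
key b = concat (applyUpTo (keyRows b) (length b))

All-keyRow : ∀ {P : Pred Cell ℓ} r n → (∀ {c} → c < n → P (cell r (suc c) r)) →
             All P (keyRow r n)
All-keyRow r = All.applyDownFrom⁺₁ (λ c → cell r (suc c) r)

record IsKeyCell (b : WeakComp) (x : Cell) : Set where
  field
    ent≡row  : ent x ≡ row x
    1≤row    : 1 ≤ row x
    row≤len  : row x ≤ length b
    1≤col    : 1 ≤ col x
    col≤part : col x ≤ part b (row x)
open IsKeyCell

∈-key⁻ : ∀ b {x} → x ∈ key b → IsKeyCell b x
∈-key⁻ b x∈key with ∈-concat⁻′ (applyUpTo (keyRows b) (length b)) x∈key
... | _ , x∈row , row∈rows with ∈-applyUpTo⁻ (keyRows b) row∈rows
... | k , k<ℓ , refl with ∈-applyDownFrom⁻ (λ c → cell (suc k) (suc c) (suc k)) x∈row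
... | c , c<n , refl = record
  { ent≡row = refl ; 1≤row = s≤s z≤n ; row≤len = k<ℓ ; 1≤col = s≤s z≤n ; col≤part = c<n }

∈-key⁺ : ∀ {b r c} → 1 ≤ r → r ≤ length b → 1 ≤ c → c ≤ part b r → cell r c r ∈ key b
∈-key⁺ {b} {suc k} {suc c} _ k<ℓ _ c<n =
  ∈-concat⁺′ (∈-applyDownFrom⁺ (λ c → cell (suc k) (suc c) (suc k)) c<n)
             (∈-applyUpTo⁺ (keyRows b) k<ℓ)

DistinctPositions : Filling → Set
DistinctPositions = AllPairs (λ x y → pos x ≢ pos y)

unique-positions : ∀ T → DistinctPositions T → Unique (map pos T)
unique-positions _ = AllPairs.map⁺

keyRow-distinct : ∀ r n → DistinctPositions (keyRow r n)
keyRow-distinct r n =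
  AllPairs.applyDownFrom⁺₁ _ n (λ j<i _ eq → <-irrefl (sym (suc-injective (cong proj₂ eq))) j<i)

key-distinct : ∀ b → DistinctPositions (key b)
key-distinct b = AllPairs.concat⁺
  (All.applyUpTo⁺₂ (keyRows b) (length b) (λ k → keyRow-distinct (suc k) (part b (suc k))))
  (AllPairs.applyUpTo⁺₁ (keyRows b) (length b) λ {k} {m} k<m _ →
    All-keyRow (suc k) (part b (suc k)) λ _ →
    All-keyRow (suc m) (part b (suc m)) λ _ eq → <-irrefl (suc-injective (cong proj₁ eq)) k<m)

count-key : ∀ {P : Pred Cell ℓ} (P? : Decidable P) b {i} → 1 ≤ i → i ≤ length b →
            (∀ {r c} → P (cell r c r) → r ≡ i) →
            count P? (key b) ≡ count P? (keyRow i (part b i))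
count-key P? b {suc k} _ k<ℓ forced = count-concat-applyUpTo P? (keyRows b) k<ℓ λ {m} m≢k →
  count-none P? (All-keyRow (suc m) (part b (suc m)) (λ _ P[x] → m≢k (suc-injective (forced P[x]))))

count-key-fullRow : ∀ {P : Pred Cell ℓ} (P? : Decidable P) b {i} → 1 ≤ i → i ≤ length b →
                    (∀ {r c} → P (cell r c r) → r ≡ i) → (∀ {c} → P (cell i c i)) →
                    count P? (key b) ≡ part b i
count-key-fullRow P? b {i} 1≤i i≤ℓ forced holds =
  trans (count-key P? b 1≤i i≤ℓ forced)
        (trans (count-all P? (All-keyRow i (part b i) (λ _ → holds)))
               (length-applyDownFrom _ (part b i)))

countRow-key : ∀ b {i} → 1 ≤ i → i ≤ length b → countRow i (key b) ≡ part b i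
countRow-key b 1≤i i≤ℓ = count-key-fullRow (λ x → row x ≟ _) b 1≤i i≤ℓ (λ r≡i → r≡i) refl

countEnt-key : ∀ b {i} → 1 ≤ i → i ≤ length b → countEnt i (key b) ≡ part b i
countEnt-key b 1≤i i≤ℓ = count-key-fullRow (λ x → ent x ≟ _) b 1≤i i≤ℓ (λ r≡i → r≡i) refl

entCol? : ∀ i c → Decidable (λ x → ent x ≡ i × col x ≡ c)
entCol? i c x = (ent x ≟ i) ×-dec (col x ≟ c)

countEntCol-keyRow-outside : ∀ {k c n} → n < c → countEntCol k c (keyRow k n) ≡ 0
countEntCol-keyRow-outside {k} {c} {n} n<c = count-none (entCol? k c)
  (All-keyRow k n (λ c′<n (_ , c′≡c) → <-irrefl c′≡c (≤-<-trans c′<n n<c)))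

countEntCol-keyRow-inside : ∀ {k c n} → 1 ≤ c → c ≤ n → countEntCol k c (keyRow k n) ≡ 1
countEntCol-keyRow-inside {n = zero} () z≤n
countEntCol-keyRow-inside {k} {c} {suc n} 1≤c c≤1+n with c ≟ suc n
... | yes refl = trans (count-accept (entCol? k c) (keyRow k n) (refl , refl))
                      (cong suc (countEntCol-keyRow-outside {k} {c} {n} ≤-refl))
... | no c≢1+n = trans (count-reject (entCol? k c) {cell k (suc n) k} (keyRow k n)
                                    (λ (_ , 1+n≡c) → c≢1+n (sym 1+n≡c)))
                      (countEntCol-keyRow-inside {k} {c} {n} 1≤c (≤-pred (≤∧≢⇒< c≤1+n c≢1+n)))

countEntCol-key : ∀ b {i c} → 1 ≤ i → i ≤ length b →
                  countEntCol i c (key b) ≡ countEntCol i c (keyRow i (part b i))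
countEntCol-key b {i} {c} 1≤i i≤ℓ = count-key (entCol? i c) b 1≤i i≤ℓ proj₁

ent≡row-key : ∀ b {x} → x ∈ key b → ent x ≡ row x
ent≡row-key b x∈key = ent≡row (∈-key⁻ b x∈key)

key-isKohnertTableau : ∀ b → IsKohnertTableau b (key b)
key-isKohnertTableau b = record
  { distinct = unique-positions (key b) (key-distinct b)
  ; rowPos   = λ _ x∈key → 1≤row (∈-key⁻ b x∈key)
  ; colPos   = λ _ x∈key → 1≤col (∈-key⁻ b x∈key)
  ; entRange = λ _ x∈key → let x-key = ∈-key⁻ b x∈key in
                 subst (1 ≤_) (sym (ent≡row x-key)) (1≤row x-key) ,
                 subst (_≤ length b) (sym (ent≡row x-key)) (row≤len x-key)
  ; content  = λ _ → countEnt-key b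
  ; condI    = λ _ 1≤i i≤ℓ c 1≤c c≤bᵢ →
                 trans (countEntCol-key b 1≤i i≤ℓ) (countEntCol-keyRow-inside 1≤c c≤bᵢ)
  ; condII   = λ _ x∈key → ≤-reflexive (sym (ent≡row-key b x∈key))
  ; condIII  = λ _ _ x∈key y∈key ents≡ _ →
                 ≤-reflexive (trans (sym (ent≡row-key b y∈key)) (trans (sym ents≡) (ent≡row-key b x∈key)))
  ; condIV   = λ _ _ x∈key y∈key ent< _ row< → contradiction
                 (subst₂ _<_ (ent≡row-key b x∈key) (ent≡row-key b y∈key) ent<) (<-asym row<)
  }

key-quasiYamanouchi : ∀ b → QuasiYamanouchi (key b)
key-quasiYamanouchi b x x∈key = inj₁ (x , x∈key , refl , ent≡row-key b x∈key)

lowerKeyCell : WeakComp → ℕ → ℕ → Filling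
lowerKeyCell a i j = cell i (part a j) j ∷ key (decrementAt j a)

module Lowering (a : WeakComp) {i j : ℕ} (1≤i : 1 ≤ i) (i<j : i < j) (j≤ℓ : j ≤ length a)
                (0<aᵢ : 0 < part a i) (aᵢ<aⱼ : part a i < part a j)
                (aₖ≤aᵢ : ∀ {k} → i < k → k < j → part a k ≤ part a i) where

  private
    a′ : WeakComp
    a′ = decrementAt j a

    lowered : Cell
    lowered = cell i (part a j) j

    T′ : Filling
    T′ = lowerKeyCell a i j

    module K′ = IsKohnertTableau (key-isKohnertTableau a′)

    ℓ′≡ℓ : length a′ ≡ length a
    ℓ′≡ℓ = length-decrementAt j a

    ≤ℓ⇒≤ℓ′ : ∀ {k} → k ≤ length a → k ≤ length a′
    ≤ℓ⇒≤ℓ′ = subst (_ ≤_) (sym ℓ′≡ℓ)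

    i≤ℓ : i ≤ length a
    i≤ℓ = <⇒≤ (<-≤-trans i<j j≤ℓ)

    a′ᵢ≡aᵢ : part a′ i ≡ part a i
    a′ᵢ≡aᵢ = part-decrementAt-≢ j a (<⇒≢ i<j)

    1+a′ⱼ≡aⱼ : suc (part a′ j) ≡ part a j
    1+a′ⱼ≡aⱼ = trans (cong suc (part-decrementAt-≡ j a))
                     (suc-pred (part a j) {{>-nonZero (<-trans 0<aᵢ aᵢ<aⱼ)}})

    a′ⱼ<aⱼ : part a′ j < part a j
    a′ⱼ<aⱼ = subst (part a′ j <_) 1+a′ⱼ≡aⱼ ≤-refl

    open ≤-Reasoning

    col<aⱼ : ∀ {y} → y ∈ key a′ → ent y ≡ j → col y < part a j
    col<aⱼ {y} y∈key entʸ≡j = begin-strict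
      col y            ≤⟨ col≤part (∈-key⁻ a′ y∈key) ⟩
      part a′ (row y)  ≡⟨ cong (part a′) (trans (sym (ent≡row-key a′ y∈key)) entʸ≡j) ⟩
      part a′ j        <⟨ a′ⱼ<aⱼ ⟩
      part a j         ∎

    col≤aᵢ : ∀ {x} → x ∈ key a′ → i < row x → row x < j → col x ≤ part a i
    col≤aᵢ {x} x∈key i<rowˣ rowˣ<j = begin
      col x            ≤⟨ col≤part (∈-key⁻ a′ x∈key) ⟩
      part a′ (row x)  ≡⟨ part-decrementAt-≢ j a (<⇒≢ rowˣ<j) ⟩
      part a (row x)   ≤⟨ aₖ≤aᵢ i<rowˣ rowˣ<j ⟩
      part a i         ∎

    rowᵢ-col≤aᵢ : ∀ {y} → y ∈ key a′ → row y ≡ i → col y ≤ part a i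
    rowᵢ-col≤aᵢ {y} y∈key rowʸ≡i = begin
      col y            ≤⟨ col≤part (∈-key⁻ a′ y∈key) ⟩
      part a′ (row y)  ≡⟨ cong (part a′) rowʸ≡i ⟩
      part a′ i        ≡⟨ a′ᵢ≡aᵢ ⟩
      part a i         ∎

    countRowᵢ : countRow i T′ ≡ suc (part a i)
    countRowᵢ = trans (count-accept (λ x → row x ≟ i) (key a′) refl)
                      (cong suc (trans (countRow-key a′ 1≤i (≤ℓ⇒≤ℓ′ i≤ℓ)) a′ᵢ≡aᵢ))

    distinct : Unique (map pos T′)
    distinct = unique-positions T′ (lowered-apart ∷ key-distinct a′)
      where
      lowered-apart : All (λ y → pos lowered ≢ pos y) (key a′)
      lowered-apart = All.tabulate λ y∈key pos≡ →
        <⇒≱ aᵢ<aⱼ (subst (_≤ part a i) (sym (cong proj₂ pos≡))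
                         (rowᵢ-col≤aᵢ y∈key (sym (cong proj₁ pos≡))))

    content : ∀ k → 1 ≤ k → k ≤ length a → countEnt k T′ ≡ part a k
    content k 1≤k k≤ℓ with j ≟ k
    ... | yes refl = trans (count-accept (λ x → ent x ≟ j) (key a′) refl)
                           (trans (cong suc (countEnt-key a′ 1≤k (≤ℓ⇒≤ℓ′ k≤ℓ))) 1+a′ⱼ≡aⱼ)
    ... | no j≢k   = trans (count-reject (λ x → ent x ≟ k) {lowered} (key a′) j≢k)
                           (trans (countEnt-key a′ 1≤k (≤ℓ⇒≤ℓ′ k≤ℓ))
                                  (part-decrementAt-≢ j a (j≢k ∘ sym)))

    condI : ∀ k → 1 ≤ k → k ≤ length a → ∀ c → 1 ≤ c → c ≤ part a k → countEntCol k c T′ ≡ 1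
    condI k 1≤k k≤ℓ c 1≤c c≤aₖ with j ≟ k | part a j ≟ c
    ... | yes refl | yes refl = trans (count-accept (entCol? j c) (key a′) (refl , refl))
      (cong suc (trans (countEntCol-key a′ 1≤k (≤ℓ⇒≤ℓ′ k≤ℓ)) (countEntCol-keyRow-outside a′ⱼ<aⱼ)))
    ... | yes refl | no aⱼ≢c = trans (count-reject (entCol? j c) {lowered} (key a′) (aⱼ≢c ∘ proj₂))
      (trans (countEntCol-key a′ 1≤k (≤ℓ⇒≤ℓ′ k≤ℓ))
             (countEntCol-keyRow-inside 1≤c
               (≤-pred (subst (c <_) (sym 1+a′ⱼ≡aⱼ) (≤∧≢⇒< c≤aₖ (aⱼ≢c ∘ sym))))))
    ... | no j≢k   | _ = trans (count-reject (entCol? k c) {lowered} (key a′) (j≢k ∘ proj₁))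
      (trans (countEntCol-key a′ 1≤k (≤ℓ⇒≤ℓ′ k≤ℓ))
             (countEntCol-keyRow-inside 1≤c
               (subst (c ≤_) (sym (part-decrementAt-≢ j a (j≢k ∘ sym))) c≤aₖ)))

    condIII : ∀ x y → x ∈ T′ → y ∈ T′ → ent x ≡ ent y → col x < col y → row y ≤ row x
    condIII x y (here refl)   (here refl)   _     colˣ<colʸ = contradiction colˣ<colʸ (<-irrefl refl)
    condIII x y (here refl)   (there y∈key) ents≡ colˣ<colʸ =
      contradiction colˣ<colʸ (<-asym (col<aⱼ y∈key (sym ents≡)))
    condIII x y (there x∈key) (here refl)   ents≡ _ =
      subst (i ≤_) (trans (sym ents≡) (ent≡row-key a′ x∈key)) (<⇒≤ i<j)
    condIII x y (there x∈key) (there y∈key) = K′.condIII x y x∈key y∈key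

    condIV : ∀ x y → x ∈ T′ → y ∈ T′ → ent x < ent y → col x ≡ col y → row y < row x →
             ∃[ z ] (z ∈ T′ × ent z ≡ ent x × col z ≡ suc (col y) × row y < row z)
    condIV x y (here refl)   (here refl)   entˣ<entʸ _ _ = contradiction entˣ<entʸ (<-irrefl refl)
    condIV x y (here refl)   (there y∈key) entˣ<entʸ _ rowʸ<rowˣ =
      contradiction (<-trans i<j (subst (j <_) (ent≡row-key a′ y∈key) entˣ<entʸ)) (<-asym rowʸ<rowˣ)
    condIV x y (there x∈key) (here refl)   entˣ<entʸ cols≡ rowʸ<rowˣ =
      contradiction (subst (_≤ part a i) cols≡
                      (col≤aᵢ x∈key rowʸ<rowˣ (subst (_< j) (ent≡row-key a′ x∈key) entˣ<entʸ)))
                    (<⇒≱ aᵢ<aⱼ)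
    condIV x y (there x∈key) (there y∈key) entˣ<entʸ cols≡ rowʸ<rowˣ
      with z , z∈key , z-props ← K′.condIV x y x∈key y∈key entˣ<entʸ cols≡ rowʸ<rowˣ
      = z , there z∈key , z-props

  isKohnertTableau : IsKohnertTableau a T′
  isKohnertTableau = record
    { distinct = distinct
    ; rowPos   = λ where _ (here refl) → 1≤i ; x (there x∈key) → K′.rowPos x x∈key
    ; colPos   = λ where _ (here refl) → <-trans 0<aᵢ aᵢ<aⱼ ; x (there x∈key) → K′.colPos x x∈key
    ; entRange = λ where _ (here refl) → ≤-trans 1≤i (<⇒≤ i<j) , j≤ℓ
                         x (there x∈key) → map₂ (subst (_ ≤_) ℓ′≡ℓ) (K′.entRange x x∈key)
    ; content  = content
    ; condI    = condI
    ; condII   = λ where _ (here refl) → <⇒≤ i<j ; x (there x∈key) → K′.condII x x∈key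
    ; condIII  = condIII
    ; condIV   = condIV
    }

  quasiYamanouchi : QuasiYamanouchi T′
  quasiYamanouchi _ (here refl) =
    inj₁ (cell i 1 i , there (∈-key⁺ {a′} 1≤i (≤ℓ⇒≤ℓ′ i≤ℓ) ≤-refl (subst (1 ≤_) (sym a′ᵢ≡aᵢ) 0<aᵢ)) ,
          refl , refl)
  quasiYamanouchi x (there x∈key) = inj₁ (x , there x∈key , refl , ent≡row-key a′ x∈key)

  wt-≢ : wt (length a) (key a) ≢ wt (length a) T′
  wt-≢ = countRow-≢⇒wt-≢ (key a) T′ 1≤i i≤ℓ
           (λ rows≡ → 1+n≢n (sym (trans (sym (countRow-key a 1≤i i≤ℓ)) (trans rows≡ countRowᵢ))))

lemma3p3 : (a : WeakComp) (i j : ℕ) →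
    1 ≤ i → i < j → j ≤ length a →
    0 < part a i → part a i < part a j →
    ∃[ T ] ∃[ T′ ] (IsQKT a T × IsQKT a T′ × wt (length a) T ≢ wt (length a) T′)
lemma3p3 a i j 1≤i i<j j≤ℓ 0<aᵢ aᵢ<aⱼ
  with m , (i<m , aᵢ<aₘ) , below-m ←
         least-witness (λ k → (i <? k) ×-dec (part a i <? part a k)) (i<j , aᵢ<aⱼ) =
  key a , lowerKeyCell a i m ,
  (key-isKohnertTableau a , key-quasiYamanouchi a) ,
  (L.isKohnertTableau , L.quasiYamanouchi) , L.wt-≢
  where
  m≤j : m ≤ j
  m≤j = ≮⇒≥ (λ j<m → below-m j<m (i<j , aᵢ<aⱼ))

  module L = Lowering a 1≤i i<m (≤-trans m≤j j≤ℓ) 0<aᵢ aᵢ<aₘ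
                      (λ i<k k<m → ≮⇒≥ (λ aᵢ<aₖ → below-m k<m (i<k , aᵢ<aₖ)))
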